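{- For instances of fixed order scheduling with deadlines in which the slacks are non-increasing along the fixed order ($d_1-p_1\ge d_2-p_2\ge\cdots\ge d_n-p_n$), the first-fit algorithm is a $2$-approximation, i.e. $FF(I)\le 2\,OPT(I)$ for every such instance $I$; moreover this bound is tight: for every $\varepsilon>0$ there is such an instance with $FF(I)/OPT(I)>2-\varepsilon$.
   Context: Fixed order scheduling with deadlines: there are $n$ jobs $1,\dots,n$, job $j$ having processing time $p_j\in\mathbb{N}$, $p_j>0$, and deadline $d_j\in\mathbb{N}$ with $d_j\ge p_j$; the slack of job $j$ is $d_j-p_j$. All jobs are released at time $0$, and there are sufficiently many identical machines. Each machine processes its assigned jobs non-preemptively, without idle time, in increasing order of job index. A schedule is feasible if, for every job $j$, the total processing time of jobs $k\le j$ on the machine of $j$ is at most $d_j$. $OPT(I)$ is the minimum number of machines used (receiving at least one job) by a feasible schedule. The first-fit algorithm considers jobs in order $1,\dots,n$ and appends each job to the lowest-indexed open machine on which it would meet its deadline, opening a new machine if there is none; $FF(I)$ is the number of machines it opens. -}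

module Defs where

open import Data.Nat using (ℕ; zero; suc; _+_; _∸_; _≤_; _<_; _≤?_)
open import Data.Nat.Properties using ()
open import Data.Fin using (Fin; toℕ)
open import Data.Fin.Properties using (any?) renaming (_≟_ to _≟ᶠ_)
open import Data.List using (List; []; _∷_; length; lookup; filter; map; allFin; foldl)
open import Data.Nat.ListAction using (sum)
open import Data.List.Relation.Unary.All using (All)
open import Data.List.Relation.Unary.Linked using (Linked)
open import Data.Product using (Σ; ∃; _×_; _,_)
open import Relation.Nullary using (¬_)
open import Relation.Nullary.Decidable using (_×-dec_)
open import Relation.Binary.PropositionalEquality using (_≡_)

record Job : Set where
  constructor job
  field
    p : ℕ
    d : ℕ
open Job public

slack : Job → ℕ
slack j = d j ∸ p j

-- An instance: the jobs listed in the fixed order 1,…,n.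
Instance : Set
Instance = List Job

ValidInstance : Instance → Set
ValidInstance I = All (λ j → (0 < p j) × (p j ≤ d j)) I

NonIncreasingSlack : Instance → Set
NonIncreasingSlack I = Linked (λ a b → slack b ≤ slack a) I

Schedule : Instance → ℕ → Set
Schedule I m = Fin (length I) → Fin m

completion : (I : Instance) {m : ℕ} → Schedule I m → Fin (length I) → ℕ
completion I σ j =
  sum (map (λ k → p (lookup I k))
           (filter (λ k → (toℕ k ≤? toℕ j) ×-dec (σ k ≟ᶠ σ j)) (allFin (length I))))

Feasible : (I : Instance) {m : ℕ} → Schedule I m → Set
Feasible I σ = ∀ j → completion I σ j ≤ d (lookup I j)

machinesUsed : (I : Instance) {m : ℕ} → Schedule I m → ℕ
machinesUsed I {m} σ = length (filter (λ i → any? (λ k → σ k ≟ᶠ i)) (allFin m))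

IsOPT : Instance → ℕ → Set
IsOPT I k =
  (Σ ℕ λ m → Σ (Schedule I m) λ σ → Feasible I σ × machinesUsed I σ ≡ k)
  × (∀ m (σ : Schedule I m) → Feasible I σ → k ≤ machinesUsed I σ)

-- First fit. The state is the list of loads of the open machines
-- (in order of opening). A job goes to the first machine on which it meets
-- its deadline, else a new machine is opened.
ffInsert : Job → List ℕ → List ℕ
ffInsert jb [] = p jb ∷ []
ffInsert jb (l ∷ ls) with l + p jb ≤? d jb
... | Relation.Nullary.yes _ = (l + p jb) ∷ ls
... | Relation.Nullary.no _  = l ∷ ffInsert jb ls

ffLoads : Instance → List ℕ
ffLoads I = foldl (λ ls jb → ffInsert jb ls) [] I

FF : Instance → ℕ
FF I = length (ffLoads I)

module Submission where

open import Defs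

-- With non-increasing slacks, a machine that cannot take a job has load above its slack and
-- hence above every later slack, so first fit only ever adds to its newest machine: it is
-- next fit. Run next fit alongside a feasible schedule σ on U machines, calling a machine of σ
-- active while jobs are still to come on it; the load of an active machine is at most the
-- current slack s. A bin closed while some machine of σ finished is charged to that machine,
-- at most once each. Every other closed bin held more than s, all of it on active machines,
-- and the potential (r ∸ k) * s + L ≤ A (r such bins, k finished machines, L the load of the
-- current bin, A the active load) survives every step and gives r < U. Hence next fit opens at
-- most 1 + U + (U - 1) bins. For tightness, an instance of constant slack N fits on N + 1
-- machines while next fit opens 2N + 1 bins.

module UpperBound where

  import Data.Nat.Properties as ℕ
  open import Algebra.Properties.Semiring.Sum ℕ.+-*-semiring
    using (sum-remove; sum-cong-≗; sum-replicate-zero; *-distribʳ-sum)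
    renaming (sum to ∑)
  open import Algebra.Properties.CommutativeSemigroup ℕ.+-commutativeSemigroup
    using (xy∙z≈zy∙x; xy∙z≈x∙zy)
  open import Data.Bool using (Bool; true; false; if_then_else_; _∨_)
  open import Data.Fin using (Fin; zero; suc; toℕ; punchIn)
  open import Data.Fin.Properties using (any?; punchInᵢ≢i) renaming (_≟_ to _≟ᶠ_)
  open import Data.List
    using (List; []; _∷_; _++_; length; lookup; filter; map; tabulate; foldl)
  open import Data.List.Membership.Propositional using (lose)
  open import Data.List.Membership.Propositional.Properties using (∈-allFin)
  open import Data.List.Properties using (length-++; ++-assoc; filter-some)
  open import Data.List.Relation.Unary.All as All using (All; []; _∷_)
  open import Data.List.Relation.Unary.All.Properties using (++⁺)
  import Data.List.Relation.Unary.Linked as Linked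
  open import Data.List.Relation.Unary.Linked.Properties using (Linked⇒All)
  open import Data.Nat
  open import Data.Nat.ListAction using (sum)
  open import Data.Nat.Properties
  open import Data.Nat.Tactic.RingSolver using (solve-∀)
  open import Data.Product using (_×_; _,_)
  open import Data.Unit using (⊤; tt)
  open import Data.Vec.Functional using (Vector)
  open import Function using (_∘_)
  open import Relation.Binary.PropositionalEquality
  open import Relation.Nullary using (does; yes; no; contradiction)
  open import Relation.Nullary.Decidable using (dec-true; dec-false; _×-dec_)
  open import Relation.Unary using (Pred; Decidable)

  ∑-mono-≤ : ∀ {n} {f g : Vector ℕ n} → (∀ i → f i ≤ g i) → ∑ f ≤ ∑ g
  ∑-mono-≤ {zero}  f≤g = z≤n
  ∑-mono-≤ {suc n} f≤g = +-mono-≤ (f≤g zero) (∑-mono-≤ (f≤g ∘ suc))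

  ∑-cong-except : ∀ {n} {f g : Vector ℕ n} (i : Fin n) → (∀ j → j ≢ i → f j ≡ g j) →
                  ∑ f + g i ≡ ∑ g + f i
  ∑-cong-except {suc n} {f} {g} i f≗g = begin
    ∑ f + g i                     ≡⟨ cong (_+ g i) (sum-remove f) ⟩
    f i + ∑ (f ∘ punchIn i) + g i ≡⟨ cong (λ r → f i + r + g i) (sum-cong-≗ f≗g∘punchIn) ⟩
    f i + ∑ (g ∘ punchIn i) + g i ≡⟨ xy∙z≈zy∙x (f i) _ (g i) ⟩
    g i + ∑ (g ∘ punchIn i) + f i ≡⟨ cong (_+ f i) (sum-remove g) ⟨
    ∑ g + f i                     ∎
    where
    open ≡-Reasoning
    f≗g∘punchIn : ∀ j → f (punchIn i j) ≡ g (punchIn i j)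
    f≗g∘punchIn j = f≗g _ (punchInᵢ≢i i j)

  module _ {A : Set} {p} {P : Pred A p} (P? : Decidable P) where

    sum-filter-tabulate : ∀ {n} (g : Fin n → A) (w : A → ℕ) →
      sum (map w (filter P? (tabulate g))) ≡ ∑ (λ i → if does (P? (g i)) then w (g i) else 0)
    sum-filter-tabulate {zero}  g w = refl
    sum-filter-tabulate {suc n} g w with does (P? (g zero))
    ... | true  = cong (w (g zero) +_) (sum-filter-tabulate (g ∘ suc) w)
    ... | false = sum-filter-tabulate (g ∘ suc) w

    length-filter-tabulate : ∀ {n} (g : Fin n → A) →
      length (filter P? (tabulate g)) ≡ ∑ (λ i → if does (P? (g i)) then 1 else 0)
    length-filter-tabulate {zero}  g = refl
    length-filter-tabulate {suc n} g with does (P? (g zero))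
    ... | true  = cong suc (length-filter-tabulate (g ∘ suc))
    ... | false = length-filter-tabulate (g ∘ suc)

  addLoad : ∀ {M} → Vector ℕ M → Fin M → ℕ → Vector ℕ M
  addLoad ℓ ν a μ = ℓ μ + (if does (ν ≟ᶠ μ) then a else 0)

  addLoad-self : ∀ {M} (ℓ : Vector ℕ M) ν a → addLoad ℓ ν a ν ≡ ℓ ν + a
  addLoad-self ℓ ν a rewrite dec-true (ν ≟ᶠ ν) refl = refl

  addLoad-other : ∀ {M} (ℓ : Vector ℕ M) {ν μ} a → ν ≢ μ → addLoad ℓ ν a μ ≡ ℓ μ
  addLoad-other ℓ {ν} {μ} a ν≢μ rewrite dec-false (ν ≟ᶠ μ) ν≢μ = +-identityʳ (ℓ μ)

  FeasibleFrom : ∀ {M} → Vector ℕ M → (I : Instance) → Schedule I M → Set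
  FeasibleFrom ℓ []      σ = ⊤
  FeasibleFrom ℓ (x ∷ I) σ =
    ℓ (σ zero) + p x ≤ d x × FeasibleFrom (addLoad ℓ (σ zero) (p x)) I (σ ∘ suc)

  module _ {m : ℕ} where

    private
      does-≤?-suc : ∀ a b → does (suc a ≤? suc b) ≡ does (a ≤? b)
      does-≤?-suc zero    b = refl
      does-≤?-suc (suc a) b = refl

    completion-∑ : ∀ I (σ : Schedule I m) j → completion I σ j ≡
      ∑ (λ k → if does ((toℕ k ≤? toℕ j) ×-dec (σ k ≟ᶠ σ j)) then p (lookup I k) else 0)
    completion-∑ I σ j = sum-filter-tabulate _ (λ k → k) (λ k → p (lookup I k))

    completion-zero : ∀ x I (σ : Schedule (x ∷ I) m) → completion (x ∷ I) σ zero ≡ p x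
    -- The summands for later jobs k compute to 0, since suc (toℕ k) ≤? 0 reduces to no.
    completion-zero x I σ = begin
      completion (x ∷ I) σ zero
        ≡⟨ completion-∑ (x ∷ I) σ zero ⟩
      (if does (σ zero ≟ᶠ σ zero) then p x else 0) + ∑ {length I} (λ _ → 0)
        ≡⟨ cong₂ _+_ (cong (if_then p x else 0) (dec-true (σ zero ≟ᶠ σ zero) refl))
                     (sum-replicate-zero (length I)) ⟩
      p x + 0
        ≡⟨ +-identityʳ (p x) ⟩
      p x ∎
      where open ≡-Reasoning

    completion-suc : ∀ x I (σ : Schedule (x ∷ I) m) j → completion (x ∷ I) σ (suc j) ≡
      (if does (σ zero ≟ᶠ σ (suc j)) then p x else 0) + completion I (σ ∘ suc) j
    completion-suc x I σ j = begin
      completion (x ∷ I) σ (suc j)     ≡⟨ completion-∑ (x ∷ I) σ (suc j) ⟩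
      first + ∑ later                  ≡⟨ cong (first +_) (sum-cong-≗ later≗) ⟩
      first + ∑ later′                 ≡⟨ cong (first +_) (completion-∑ I (σ ∘ suc) j) ⟨
      first + completion I (σ ∘ suc) j ∎
      where
      open ≡-Reasoning
      first : ℕ
      first = if does (σ zero ≟ᶠ σ (suc j)) then p x else 0
      later later′ : Vector ℕ (length I)
      later  k = if does ((suc (toℕ k) ≤? suc (toℕ j)) ×-dec (σ (suc k) ≟ᶠ σ (suc j)))
                 then p (lookup I k) else 0
      later′ k = if does ((toℕ k ≤? toℕ j) ×-dec (σ (suc k) ≟ᶠ σ (suc j)))
                 then p (lookup I k) else 0
      later≗ : ∀ k → later k ≡ later′ k
      later≗ k rewrite does-≤?-suc (toℕ k) (toℕ j) = refl

    completion-shift : ∀ ℓ x I (σ : Schedule (x ∷ I) m) j →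
      ℓ (σ (suc j)) + completion (x ∷ I) σ (suc j) ≡
      addLoad ℓ (σ zero) (p x) (σ (suc j)) + completion I (σ ∘ suc) j
    completion-shift ℓ x I σ j =
      trans (cong (ℓ (σ (suc j)) +_) (completion-suc x I σ j)) (sym (+-assoc (ℓ (σ (suc j))) _ _))

    completion-bounded⇒feasibleFrom : ∀ ℓ I (σ : Schedule I m) →
      (∀ j → ℓ (σ j) + completion I σ j ≤ d (lookup I j)) → FeasibleFrom ℓ I σ
    completion-bounded⇒feasibleFrom ℓ []      σ bounded = tt
    completion-bounded⇒feasibleFrom ℓ (x ∷ I) σ bounded =
      subst (λ c → ℓ (σ zero) + c ≤ d x) (completion-zero x I σ) (bounded zero) ,
      completion-bounded⇒feasibleFrom _ I (σ ∘ suc) (λ j →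
        subst (_≤ d (lookup I j)) (completion-shift ℓ x I σ j) (bounded (suc j)))

    feasibleFrom⇒completion-bounded : ∀ ℓ I (σ : Schedule I m) →
      FeasibleFrom ℓ I σ → ∀ j → ℓ (σ j) + completion I σ j ≤ d (lookup I j)
    feasibleFrom⇒completion-bounded ℓ (x ∷ I) σ (fits , _) zero =
      subst (λ c → ℓ (σ zero) + c ≤ d x) (sym (completion-zero x I σ)) fits
    feasibleFrom⇒completion-bounded ℓ (x ∷ I) σ (_ , feasible) (suc j) =
      subst (_≤ d (lookup I j)) (sym (completion-shift ℓ x I σ j))
        (feasibleFrom⇒completion-bounded _ I (σ ∘ suc) feasible j)

  nextFit : (bins load : ℕ) → List Job → ℕ
  nextFit F L []       = F
  nextFit F L (x ∷ xs) with L ≤? slack x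
  ... | yes _ = nextFit F (L + p x) xs
  ... | no  _ = nextFit (suc F) (p x) xs

  nextFit-fits : ∀ {F L x} xs → L ≤ slack x → nextFit F L (x ∷ xs) ≡ nextFit F (L + p x) xs
  nextFit-fits {L = L} {x} xs L≤s with L ≤? slack x
  ... | yes _   = refl
  ... | no  L≰s = contradiction L≤s L≰s

  nextFit-overflows : ∀ {F L x} xs → slack x < L →
                      nextFit F L (x ∷ xs) ≡ nextFit (suc F) (p x) xs
  nextFit-overflows {L = L} {x} xs s<L with L ≤? slack x
  ... | yes L≤s = contradiction L≤s (<⇒≱ s<L)
  ... | no  _   = refl

  slacks-bounded : ∀ {x I} → NonIncreasingSlack (x ∷ I) →
                   All (λ y → slack y ≤ slack x) (x ∷ I)
  slacks-bounded {x} = Linked⇒All (λ s≥t t≥u → ≤-trans t≥u s≥t) {v = x} ≤-refl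

  ffInsert-skip : ∀ x cs ls → All (λ l → slack x < l) cs →
                  ffInsert x (cs ++ ls) ≡ cs ++ ffInsert x ls
  ffInsert-skip x []       ls []           = refl
  ffInsert-skip x (c ∷ cs) ls (s<c ∷ s<cs) with c + p x ≤? d x
  ... | yes fits = contradiction (m+n≤o⇒m≤o∸n c fits) (<⇒≱ s<c)
  ... | no  _    = cong (c ∷_) (ffInsert-skip x cs ls s<cs)

  firstFit-nextFit : ∀ I cs L → ValidInstance I → NonIncreasingSlack I →
    All (λ l → All (λ y → slack y < l) I) cs →
    length (foldl (λ ls y → ffInsert y ls) (cs ++ L ∷ []) I) ≡ nextFit (suc (length cs)) L I
  firstFit-nextFit []      cs L _ _ _ = trans (length-++ cs) (+-comm (length cs) 1)
  firstFit-nextFit (x ∷ I) cs L ((_ , p≤d) ∷ valid) noninc closed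
    rewrite ffInsert-skip x cs (L ∷ []) (All.map All.head closed)
    with L + p x ≤? d x | L ≤? slack x
  ... | yes _    | yes _   =
    firstFit-nextFit I cs (L + p x) valid (Linked.tail noninc) (All.map All.tail closed)
  ... | yes fits | no L≰s  = contradiction (m+n≤o⇒m≤o∸n L fits) L≰s
  ... | no L+p≰d | yes L≤s = contradiction (m≤o∸n⇒m+n≤o L p≤d L≤s) L+p≰d
  ... | no _     | no L≰s
    rewrite sym (++-assoc cs (L ∷ []) (p x ∷ [])) =
    trans (firstFit-nextFit I (cs ++ L ∷ []) (p x) valid (Linked.tail noninc)
            (++⁺ (All.map All.tail closed) (L-closed ∷ [])))
          (cong (λ n → nextFit (suc n) (p x) I)
                (trans (length-++ cs) (+-comm (length cs) 1)))
    where
    L-closed : All (λ y → slack y < L) I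
    L-closed = All.map (λ y≤x → ≤-<-trans y≤x (≰⇒> L≰s)) (All.tail (slacks-bounded noninc))

  firstFit≡nextFit : ∀ {x I} → ValidInstance (x ∷ I) → NonIncreasingSlack (x ∷ I) →
    FF (x ∷ I) ≡ nextFit 1 0 (x ∷ I)
  firstFit≡nextFit {x} {I} (_ ∷ valid) noninc =
    firstFit-nextFit I [] (p x) valid (Linked.tail noninc) []

  -- The state of next fit (F bins, the last of load L) run alongside a schedule on U machines
  -- that has α active machines of total load A, while no job to come has slack above s. Of
  -- the closed bins, `charged` were closed while a machine finished and `overfull` were not;
  -- `fresh` says that no machine has finished since the current bin was opened.
  record Charging (U s A α F L : ℕ) : Set where
    field
      finished charged overfull : ℕ
      fresh      : Bool
      machines   : finished + α ≤ U
      bins       : F ≡ suc (charged + overfull)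
      charging   : (if fresh then charged else suc charged) ≤ finished
      potential  : (overfull ∸ finished) * s + (if fresh then L else 0) ≤ A
      overfull<U : overfull < U

    charged≤finished : charged ≤ finished
    charged≤finished = from fresh charging
      where
      from : ∀ b → (if b then charged else suc charged) ≤ finished → charged ≤ finished
      from true  a≤k = a≤k
      from false a<k = <⇒≤ a<k

    overfull-load : (overfull ∸ finished) * s ≤ A
    overfull-load = ≤-trans (m≤m+n _ _) potential

  module _ {U : ℕ} where

    Charging-init : ∀ {s A α} → 0 < U → α ≤ U → Charging U s A α 1 0
    Charging-init 0<U α≤U = record
      { finished = 0 ; charged = 0 ; overfull = 0 ; fresh = true
      ; machines = α≤U ; bins = refl ; charging = z≤n ; potential = z≤n ; overfull<U = 0<U }

    Charging-final : ∀ {s A α F L} → Charging U s A α F L → F ≤ 2 * U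
    Charging-final {F = F} c = begin
      F                        ≡⟨ bins ⟩
      suc (charged + overfull) ≡⟨ +-suc charged overfull ⟨
      charged + suc overfull   ≤⟨ +-mono-≤ charged≤U overfull<U ⟩
      U + U                    ≡⟨ cong (U +_) (+-identityʳ U) ⟨
      2 * U                    ∎
      where
      open Charging c
      open ≤-Reasoning
      charged≤U : charged ≤ U
      charged≤U = ≤-trans charged≤finished (≤-trans (m≤m+n finished _) machines)

    Charging-antitone : ∀ {s s′ A α F L} → s′ ≤ s →
                        Charging U s A α F L → Charging U s′ A α F L
    Charging-antitone s′≤s c = record
      { finished = finished ; charged = charged ; overfull = overfull ; fresh = fresh
      ; machines = machines ; bins = bins ; charging = charging
      ; potential = ≤-trans (+-monoˡ-≤ _ (*-monoʳ-≤ (overfull ∸ finished) s′≤s)) potential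
      ; overfull<U = overfull<U }
      where open Charging c

    private
      suc∸-≤ : ∀ r k → suc r ∸ k ≤ suc (r ∸ k)
      suc∸-≤ r k = m≤n+o⇒m∸n≤o (suc r) k
        (≤-trans (s≤s (m≤n+m∸n r k)) (≤-reflexive (sym (+-suc k (r ∸ k)))))

    overflow<U : ∀ {s A α k r L} → s < L → (r ∸ k) * s + L ≤ A → A ≤ α * s →
                 k + α ≤ U → suc r < U
    overflow<U {s} {A} {α} {k} {r} {L} s<L potential A≤αs k+α≤U =
      *-cancelʳ-< s (suc r) U (begin-strict
      s + r * s               <⟨ +-monoˡ-< (r * s) s<L ⟩
      L + r * s               ≤⟨ +-monoʳ-≤ L (*-monoˡ-≤ s (m≤n+m∸n r k)) ⟩
      L + (k + (r ∸ k)) * s   ≡⟨ rearrange L k (r ∸ k) s ⟩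
      (r ∸ k) * s + L + k * s ≤⟨ +-monoˡ-≤ (k * s) potential ⟩
      A + k * s               ≤⟨ +-monoˡ-≤ (k * s) A≤αs ⟩
      α * s + k * s           ≡⟨ *-distribʳ-+ s α k ⟨
      (α + k) * s             ≤⟨ *-monoˡ-≤ s (≤-trans (≤-reflexive (+-comm α k)) k+α≤U) ⟩
      U * s                   ∎)
      where
      open ≤-Reasoning
      rearrange : ∀ L k t s → L + (k + t) * s ≡ t * s + L + k * s
      rearrange = solve-∀

    Charging-close : ∀ {s A α F L} → s < L → A ≤ α * s →
                     Charging U s A α F L → Charging U s A α (suc F) 0
    Charging-close {s} {A} {α} {F} {L} s<L A≤αs c = close fresh charging potential
      where
      open Charging c
      close : ∀ b → (if b then charged else suc charged) ≤ finished →
              (overfull ∸ finished) * s + (if b then L else 0) ≤ A → Charging U s A α (suc F) 0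
      close true a≤k potential = record
        { finished = finished ; charged = charged ; overfull = suc overfull ; fresh = true
        ; machines = machines ; bins = cong suc (trans bins (sym (+-suc charged overfull)))
        ; charging = a≤k
        ; potential = begin
            (suc overfull ∸ finished) * s + 0 ≡⟨ +-identityʳ _ ⟩
            (suc overfull ∸ finished) * s     ≤⟨ *-monoˡ-≤ s (suc∸-≤ overfull finished) ⟩
            s + (overfull ∸ finished) * s     ≤⟨ +-monoˡ-≤ _ (<⇒≤ s<L) ⟩
            L + (overfull ∸ finished) * s     ≡⟨ +-comm L _ ⟩
            (overfull ∸ finished) * s + L     ≤⟨ potential ⟩
            A                                 ∎
        ; overfull<U = overflow<U {α = α} {k = finished} s<L potential A≤αs machines }
        where open ≤-Reasoning
      close false a<k potential = record
        { finished = finished ; charged = suc charged ; overfull = overfull ; fresh = true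
        ; machines = machines ; bins = cong suc bins ; charging = a<k
        ; potential = potential ; overfull<U = overfull<U }

    Charging-stay : ∀ {s A A′ α α′ F L q} → A + q ≤ A′ → α′ ≤ α →
                    Charging U s A α F L → Charging U s A′ α′ F (L + q)
    Charging-stay {s} {A} {A′} {L = L} {q} A+q≤A′ α′≤α c = record
      { finished = finished ; charged = charged ; overfull = overfull ; fresh = fresh
      ; machines = ≤-trans (+-monoʳ-≤ finished α′≤α) machines ; bins = bins ; charging = charging
      ; potential = grow fresh potential ; overfull<U = overfull<U }
      where
      open Charging c
      grow : ∀ b → (overfull ∸ finished) * s + (if b then L else 0) ≤ A →
                   (overfull ∸ finished) * s + (if b then L + q else 0) ≤ A′
      grow true  pot =
        ≤-trans (≤-reflexive (sym (+-assoc _ L q))) (≤-trans (+-monoˡ-≤ q pot) A+q≤A′)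
      grow false pot = ≤-trans pot (≤-trans (m≤m+n A q) A+q≤A′)

    Charging-finish : ∀ {s A A′ α α′ F L L′} → A ≤ A′ + s → suc α′ ≤ α →
                      Charging U s A α F L → Charging U s A′ α′ F L′
    Charging-finish {s} {A} {A′} {α} {α′} A≤A′+s α′<α c = record
      { finished = suc finished ; charged = charged ; overfull = overfull ; fresh = false
      ; machines = ≤-trans (≤-reflexive (sym (+-suc finished α′)))
                           (≤-trans (+-monoʳ-≤ finished α′<α) machines)
      ; bins = bins ; charging = s≤s charged≤finished
      ; potential = begin
          (overfull ∸ suc finished) * s + 0 ≡⟨ +-identityʳ _ ⟩
          (overfull ∸ suc finished) * s     ≡⟨ cong (_* s) (pred[m∸n]≡m∸[1+n] overfull finished) ⟨
          pred excess * s                   ≤⟨ pred-*-≤ excess (≤-trans overfull-load A≤A′+s) ⟩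
          A′                                ∎
      ; overfull<U = overfull<U }
      where
      open Charging c
      open ≤-Reasoning
      excess = overfull ∸ finished
      pred-*-≤ : ∀ t → t * s ≤ A′ + s → pred t * s ≤ A′
      pred-*-≤ zero    _ = z≤n
      pred-*-≤ (suc t) h =
        +-cancelʳ-≤ s (t * s) A′ (≤-trans (≤-reflexive (+-comm (t * s) s)) h)

  module _ {M : ℕ} where

    uses : ∀ {n} → (Fin n → Fin M) → Fin M → Bool
    uses σ μ = does (any? (λ k → σ k ≟ᶠ μ))

    activeSum : ∀ {n} → (Fin n → Fin M) → Vector ℕ M → ℕ
    activeSum σ v = ∑ (λ μ → if uses σ μ then v μ else 0)

    activeCount : ∀ {n} → (Fin n → Fin M) → ℕ
    activeCount σ = activeSum σ (λ _ → 1)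

    activeSum-step : ∀ {n} (σ : Fin (suc n) → Fin M) (v v′ : Vector ℕ M) →
      (∀ μ → μ ≢ σ zero → v μ ≡ v′ μ) →
      activeSum σ v + (if uses (σ ∘ suc) (σ zero) then v′ (σ zero) else 0) ≡
      activeSum (σ ∘ suc) v′ + v (σ zero)
    activeSum-step σ v v′ v≗v′ =
      trans (∑-cong-except (σ zero) same)
            (cong (λ b → activeSum (σ ∘ suc) v′ + (if b ∨ later then v (σ zero) else 0))
                  (dec-true (σ zero ≟ᶠ σ zero) refl))
      where
      later = uses (σ ∘ suc) (σ zero)
      same : ∀ μ → μ ≢ σ zero →
             (if uses σ μ then v μ else 0) ≡ (if uses (σ ∘ suc) μ then v′ μ else 0)
      same μ μ≢ν rewrite dec-false (σ zero ≟ᶠ μ) (μ≢ν ∘ sym) | v≗v′ μ μ≢ν = refl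

    active-load-bounded : ∀ {s} I (σ : Schedule I M) ℓ {μ} → FeasibleFrom ℓ I σ →
      All (λ y → slack y ≤ s) I → uses σ μ ≡ true → ℓ μ ≤ s
    active-load-bounded (x ∷ I) σ ℓ {μ} (fits , feasible) (x≤s ∷ I≤s) used
      with σ zero ≟ᶠ μ
    ... | yes refl = ≤-trans (m+n≤o⇒m≤o∸n (ℓ μ) fits) x≤s
    ... | no  _    =
      ≤-trans (m≤m+n (ℓ μ) _) (active-load-bounded I (σ ∘ suc) _ feasible I≤s used)

    activeSum-bounded : ∀ {s} I (σ : Schedule I M) ℓ → FeasibleFrom ℓ I σ →
      All (λ y → slack y ≤ s) I → activeSum σ ℓ ≤ activeCount σ * s
    activeSum-bounded {s} I σ ℓ feasible I≤s = begin
      activeSum σ ℓ                ≤⟨ ∑-mono-≤ (λ μ → bound μ (uses σ μ) refl) ⟩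
      ∑ (λ μ → active μ * s)       ≡⟨ *-distribʳ-sum s active ⟨
      activeCount σ * s            ∎
      where
      open ≤-Reasoning
      active : Vector ℕ M
      active μ = if uses σ μ then 1 else 0
      bound : ∀ μ b → uses σ μ ≡ b → (if b then ℓ μ else 0) ≤ (if b then 1 else 0) * s
      bound μ true  used =
        ≤-trans (active-load-bounded I σ ℓ feasible I≤s used) (≤-reflexive (sym (+-identityʳ s)))
      bound μ false _    = z≤n

    Charging-place : ∀ {U n x ℓ F L} (σ : Fin (suc n) → Fin M) → ℓ (σ zero) + p x ≤ d x →
      Charging U (slack x) (activeSum σ ℓ) (activeCount σ) F L →
      Charging U (slack x) (activeSum (σ ∘ suc) (addLoad ℓ (σ zero) (p x)))
                           (activeCount (σ ∘ suc)) F (L + p x)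
    Charging-place {x = x} {ℓ} σ fits c
      with uses (σ ∘ suc) (σ zero)
         | activeSum-step σ ℓ (addLoad ℓ (σ zero) (p x))
             (λ μ μ≢ν → sym (addLoad-other ℓ (p x) (μ≢ν ∘ sym)))
         | activeSum-step σ (λ _ → 1) (λ _ → 1) (λ _ _ → refl)
    ... | true | load | count = Charging-stay (≤-reflexive load-grows) (≤-reflexive count-kept) c
      where
      ν = σ zero
      load-grows : activeSum σ ℓ + p x ≡ activeSum (σ ∘ suc) (addLoad ℓ ν (p x))
      load-grows = +-cancelʳ-≡ (ℓ ν) _ _ (begin
        activeSum σ ℓ + p x + ℓ ν
          ≡⟨ xy∙z≈x∙zy (activeSum σ ℓ) (p x) (ℓ ν) ⟩
        activeSum σ ℓ + (ℓ ν + p x)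
          ≡⟨ cong (activeSum σ ℓ +_) (addLoad-self ℓ ν (p x)) ⟨
        activeSum σ ℓ + addLoad ℓ ν (p x) ν
          ≡⟨ load ⟩
        activeSum (σ ∘ suc) (addLoad ℓ ν (p x)) + ℓ ν ∎)
        where open ≡-Reasoning
      count-kept : activeCount (σ ∘ suc) ≡ activeCount σ
      count-kept = sym (+-cancelʳ-≡ 1 _ _ count)
    ... | false | load | count = Charging-finish
      (≤-trans (≤-reflexive (trans (sym (+-identityʳ _)) load))
               (+-monoʳ-≤ _ (m+n≤o⇒m≤o∸n (ℓ (σ zero)) fits)))
      (≤-reflexive (trans (+-comm 1 _) (trans (sym count) (+-identityʳ _))))
      c

  module _ {M U : ℕ} where

    nextFit≤2*U : ∀ I (σ : Schedule I M) ℓ {s F L} → FeasibleFrom ℓ I σ →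
      All (λ y → slack y ≤ s) I → NonIncreasingSlack I →
      Charging U s (activeSum σ ℓ) (activeCount σ) F L → nextFit F L I ≤ 2 * U
    nextFit≤2*U []      σ ℓ _ _ _ c = Charging-final c
    nextFit≤2*U (x ∷ I) σ ℓ {L = L} feasible@(fits , rest) (x≤s ∷ _) noninc c
      with L ≤? slack x | Charging-antitone x≤s c
    ... | yes _   | c′ =
      nextFit≤2*U I (σ ∘ suc) _ rest (All.tail (slacks-bounded noninc)) (Linked.tail noninc)
        (Charging-place σ fits c′)
    ... | no  L≰s | c′ =
      nextFit≤2*U I (σ ∘ suc) _ rest (All.tail (slacks-bounded noninc)) (Linked.tail noninc)
        (Charging-place σ fits (Charging-close (≰⇒> L≰s) active≤ c′))
      where
      active≤ = activeSum-bounded (x ∷ I) σ ℓ feasible (slacks-bounded noninc)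

  machinesUsed≡activeCount : ∀ I {m} (σ : Schedule I m) → machinesUsed I σ ≡ activeCount σ
  machinesUsed≡activeCount I σ =
    length-filter-tabulate (λ μ → any? (λ k → σ k ≟ᶠ μ)) (λ μ → μ)

  machinesUsed-positive : ∀ x I {m} (σ : Schedule (x ∷ I) m) → 0 < machinesUsed (x ∷ I) σ
  machinesUsed-positive x I σ =
    filter-some (λ μ → any? (λ k → σ k ≟ᶠ μ)) (lose (∈-allFin (σ zero)) (zero , refl))

  firstFit≤2*machinesUsed : ∀ I {m} (σ : Schedule I m) → ValidInstance I → NonIncreasingSlack I →
    Feasible I σ → FF I ≤ 2 * machinesUsed I σ
  firstFit≤2*machinesUsed []      σ _     _      _        = z≤n
  firstFit≤2*machinesUsed (x ∷ I) σ valid noninc feasible = begin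
    FF (x ∷ I)                 ≡⟨ firstFit≡nextFit valid noninc ⟩
    nextFit 1 0 (x ∷ I)        ≤⟨ nextFit≤2*U (x ∷ I) σ (λ _ → 0)
                                    (completion-bounded⇒feasibleFrom _ (x ∷ I) σ feasible)
                                    (slacks-bounded noninc) noninc
                                    (Charging-init (machinesUsed-positive x I σ)
                                      (≤-reflexive (sym (machinesUsed≡activeCount (x ∷ I) σ)))) ⟩
    2 * machinesUsed (x ∷ I) σ ∎
    where open ≤-Reasoning

  firstFit≤2*OPT : (I : Instance) → ValidInstance I → NonIncreasingSlack I →
    (k : ℕ) → IsOPT I k → FF I ≤ 2 * k
  firstFit≤2*OPT I valid noninc k ((_ , σ , feasible , used≡k) , _) =
    subst (λ u → FF I ≤ 2 * u) used≡k (firstFit≤2*machinesUsed I σ valid noninc feasible)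

module Tightness where

  open import Data.Fin using (Fin; zero; suc)
  import Data.Fin.Properties as Fin
  open import Data.Fin.Properties using (any?) renaming (_≟_ to _≟ᶠ_)
  open import Data.Integer using (+_; -[1+_]; +<+)
  open import Data.List using (List; []; _∷_; map; allFin)
  open import Data.List.Properties using (length-filter; length-tabulate)
  open import Data.List.Relation.Unary.All as All using (All; []; _∷_)
  open import Data.List.Relation.Unary.Linked using ([]; [-]; _∷_)
  open import Data.Nat
  open import Data.Nat.Properties
  open import Data.Nat.Tactic.RingSolver using (solve-∀)
  open import Data.Product using (Σ; _×_; _,_; proj₁; proj₂)
  open import Data.Rational as ℚ using (ℚ; mkℚ; 0ℚ; 1ℚ; *<*; toℚᵘ)
  import Data.Rational.Properties as ℚ
  import Data.Rational.Unnormalised as ℚᵘ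
  import Data.Rational.Unnormalised.Properties as ℚᵘ
  open import Algebra.Properties.Group ℚ.+-0-group using (//-rightDividesʳ)
  open import Data.Unit using (tt)
  open import Function using (_∘_)
  open import Function.Definitions using (Injective)
  open import Relation.Binary.PropositionalEquality

  open UpperBound

  machinesUsed≤ : ∀ I {m} (σ : Schedule I m) → machinesUsed I σ ≤ m
  machinesUsed≤ I {m} σ =
    ≤-trans (length-filter (λ μ → any? (λ k → σ k ≟ᶠ μ)) (allFin m))
            (≤-reflexive (length-tabulate (λ μ → μ)))

  equal-slacks⇒nonIncreasing : ∀ {s} I → All (λ y → slack y ≡ s) I → NonIncreasingSlack I
  equal-slacks⇒nonIncreasing []          []                = []
  equal-slacks⇒nonIncreasing (x ∷ [])    _                 = [-]
  equal-slacks⇒nonIncreasing (x ∷ y ∷ I) (x≡s ∷ y≡s ∷ I≡s) =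
    ≤-reflexive (trans y≡s (sym x≡s)) ∷ equal-slacks⇒nonIncreasing (y ∷ I) (y≡s ∷ I≡s)

  -- All jobs have slack N, so next fit puts each unit job with the following block into a bin
  -- of load N + 1 and each big job into a bin of its own: 2N + 1 bins. Machine zero collects
  -- the unit jobs and the last big job, every other machine one block and one big job.
  module Family (n : ℕ) where

    N : ℕ
    N = suc n

    unit block big : Job
    unit  = job 1 (suc N)
    block = job N (N + N)
    big   = job (suc N) (suc N + N)

    Assignment : Set
    Assignment = List (Job × Fin (suc N))

    jobs : Assignment → Instance
    jobs = map proj₁

    machineOf : (E : Assignment) → Schedule (jobs E) (suc N)
    machineOf ((_ , μ) ∷ E) zero    = μ
    machineOf (_       ∷ E) (suc k) = machineOf E k

    chunks : ∀ {c} → (Fin c → Fin N) → Assignment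
    chunks {zero}  h = (big , zero) ∷ []
    chunks {suc c} h =
      (unit , zero) ∷ (block , suc (h zero)) ∷ (big , suc (h zero)) ∷ chunks (h ∘ suc)

    chunks-feasible : ∀ {c} (h : Fin c → Fin N) → Injective _≡_ _≡_ h →
      ∀ ℓ → ℓ zero + c ≤ N → (∀ i → ℓ (suc (h i)) ≡ 0) →
      FeasibleFrom ℓ (jobs (chunks h)) (machineOf (chunks h))
    chunks-feasible {zero} h _ ℓ hub≤N _ =
      ≤-trans (+-monoˡ-≤ (suc N) (≤-trans (≤-reflexive (sym (+-identityʳ (ℓ zero)))) hub≤N))
              (≤-reflexive (+-comm N (suc N))) ,
      tt
    chunks-feasible {suc c} h injective ℓ hub≤N idle = unit-fits , block-fits , big-fits , rest
      where
      μ = suc (h zero)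
      ℓ₁ = addLoad ℓ zero 1
      ℓ₂ = addLoad ℓ₁ μ N
      unit-fits : ℓ zero + 1 ≤ suc N
      unit-fits = ≤-trans (+-monoʳ-≤ (ℓ zero) (s≤s z≤n)) (≤-trans hub≤N (n≤1+n N))
      block-fits : ℓ₁ μ + N ≤ N + N
      block-fits = subst (λ l → l + 0 + N ≤ N + N) (sym (idle zero)) (m≤n+m N N)
      big-fits : ℓ₂ μ + suc N ≤ suc N + N
      big-fits = subst (λ l → l + suc N ≤ suc N + N)
                   (sym (trans (addLoad-self ℓ₁ μ N) (cong (λ l → l + 0 + N) (idle zero))))
                   (≤-reflexive (+-comm N (suc N)))
      other : ∀ i → μ ≢ suc (h (suc i))
      other i = Fin.0≢1+n ∘ injective ∘ Fin.suc-injective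
      hub-load : ∀ a c → a + 1 + 0 + 0 + c ≡ a + suc c
      hub-load = solve-∀
      rest = chunks-feasible (h ∘ suc) (Fin.suc-injective ∘ injective) (addLoad ℓ₂ μ (suc N))
        (≤-trans (≤-reflexive (hub-load (ℓ zero) c)) hub≤N)
        (λ i → trans (addLoad-other ℓ₂ (suc N) (other i))
                 (trans (addLoad-other ℓ₁ N (other i)) (trans (+-identityʳ _) (idle (suc i)))))

    slack-block : slack block ≡ N
    slack-block = m+n∸n≡m N N

    slack-big : slack big ≡ N
    slack-big = m+n∸m≡n (suc N) N

    chunks-jobs : ∀ {c} (h : Fin c → Fin N) →
      All (λ y → slack y ≡ N × 0 < p y × p y ≤ d y) (jobs (chunks h))
    chunks-jobs {zero}  h = (slack-big , s≤s z≤n , m≤m+n (suc N) N) ∷ []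
    chunks-jobs {suc c} h =
      (refl , s≤s z≤n , s≤s z≤n) ∷ (slack-block , s≤s z≤n , m≤m+n N N) ∷
      (slack-big , s≤s z≤n , m≤m+n (suc N) N) ∷ chunks-jobs (h ∘ suc)

    nextFit-chunks : ∀ {c} (h : Fin c → Fin N) {F L} → N < L →
      nextFit F L (jobs (chunks h)) ≡ suc (F + 2 * c)
    nextFit-chunks {zero}  h {F} {L} N<L =
      trans (nextFit-overflows {x = big} [] (subst (_< L) (sym slack-big) N<L))
            (cong suc (sym (+-identityʳ F)))
    nextFit-chunks {suc c} h {F} {L} N<L = begin
      nextFit F L (unit ∷ block ∷ big ∷ rest)
        ≡⟨ nextFit-overflows {x = unit} _ N<L ⟩
      nextFit (suc F) 1 (block ∷ big ∷ rest)
        ≡⟨ nextFit-fits {x = block} _ (subst (1 ≤_) (sym slack-block) (s≤s z≤n)) ⟩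
      nextFit (suc F) (suc N) (big ∷ rest)
        ≡⟨ nextFit-overflows {x = big} _ (subst (_< suc N) (sym slack-big) ≤-refl) ⟩
      nextFit (suc (suc F)) (suc N) rest
        ≡⟨ nextFit-chunks (h ∘ suc) ≤-refl ⟩
      suc (suc (suc F) + 2 * c)
        ≡⟨ cong suc (two-more F c) ⟩
      suc (F + 2 * suc c) ∎
      where
      open ≡-Reasoning
      rest = jobs (chunks (h ∘ suc))
      two-more : ∀ F c → suc (suc F) + 2 * c ≡ F + 2 * suc c
      two-more = solve-∀

    I : Instance
    I = jobs (chunks (λ i → i))

    valid : ValidInstance I
    valid = All.map proj₂ (chunks-jobs (λ i → i))

    nonIncreasing : NonIncreasingSlack I
    nonIncreasing = equal-slacks⇒nonIncreasing I (All.map proj₁ (chunks-jobs (λ i → i)))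

    FF-I : FF I ≡ suc (2 * N)
    FF-I = begin
      FF I                ≡⟨ firstFit≡nextFit valid nonIncreasing ⟩
      nextFit 1 0 I       ≡⟨ nextFit-overflows {x = unit} _ ≤-refl ⟨
      nextFit 0 (suc N) I ≡⟨ nextFit-chunks (λ i → i) ≤-refl ⟩
      suc (2 * N)         ∎
      where open ≡-Reasoning

    OPT-lower : ∀ m (σ : Schedule I m) → Feasible I σ → suc N ≤ machinesUsed I σ
    OPT-lower m σ feasible =
      *-cancelˡ-< 2 N _ (subst (_≤ 2 * machinesUsed I σ) FF-I
                               (firstFit≤2*machinesUsed I σ valid nonIncreasing feasible))

    isOPT : IsOPT I (suc N)
    isOPT = (suc N , σ , feasible , used≡) , OPT-lower
      where
      σ = machineOf (chunks (λ i → i))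
      feasible : Feasible I σ
      feasible = feasibleFrom⇒completion-bounded (λ _ → 0) I σ
                   (chunks-feasible (λ i → i) (λ eq → eq) (λ _ → 0) ≤-refl (λ _ → refl))
      used≡ : machinesUsed I σ ≡ suc N
      used≡ = ≤-antisym (machinesUsed≤ I σ) (OPT-lower _ σ feasible)

  -- ε ≥ 1 / D for the denominator D of ε, and (2D + 1) / (D + 1) = 2 - 1 / (D + 1).
  ratio-bound : ∀ ε → 0ℚ ℚ.< ε → let D = suc (ℚ.denominator-1 ε) in
    (1ℚ ℚ.+ 1ℚ) ℚ.- ε ℚ.< (+ suc (2 * D)) ℚ./ suc D
  ratio-bound (mkℚ (+ zero) _ _) (*<* (+<+ ()))
  ratio-bound (mkℚ -[1+ _ ] _ _) (*<* ())
  ratio-bound ε@(mkℚ (+ suc m) e _) _ =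
    subst ((1ℚ ℚ.+ 1ℚ) ℚ.- ε ℚ.<_) (//-rightDividesʳ ε q) (ℚ.+-monoˡ-< (ℚ.- ε) 2<q+ε)
    where
    D = suc e
    qᵘ = ℚᵘ.mkℚᵘ (+ suc (2 * D)) D
    q = ℚ.fromℚᵘ qᵘ
    -- 2 < q + ε with denominators cleared, in the form to which ℚᵘ's _<_ computes.
    cross : 2 * (suc D * D) < (suc (2 * D) * D + suc m * suc D) * 1
    cross = subst (2 * (suc D * D) <_) (sym (expand D m)) (m<m+n _ (s≤s z≤n))
      where
      expand : ∀ D m → (suc (2 * D) * D + suc m * suc D) * 1 ≡ 2 * (suc D * D) + suc (m * suc D)
      expand = solve-∀
    2<q+ε : 1ℚ ℚ.+ 1ℚ ℚ.< q ℚ.+ ε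
    2<q+ε = ℚ.toℚᵘ-cancel-<
      (ℚᵘ.<-respʳ-≃ (ℚᵘ.≃-sym (ℚ.toℚᵘ-homo-+ q ε))
        (ℚᵘ.<-respʳ-≃ (ℚᵘ.+-congˡ (toℚᵘ ε) (ℚᵘ.≃-sym (ℚ.toℚᵘ-fromℚᵘ qᵘ)))
          (ℚᵘ.*<* (+<+ cross))))

  firstFit-ratio-tight : (ε : ℚ) → 0ℚ ℚ.< ε →
    Σ Instance λ I → ValidInstance I × NonIncreasingSlack I ×
      Σ ℕ λ k → IsOPT I (suc k) × ((1ℚ ℚ.+ 1ℚ) ℚ.- ε ℚ.< (+ FF I) ℚ./ suc k)
  firstFit-ratio-tight ε 0<ε =
    I , valid , nonIncreasing , N , isOPT ,
    subst (λ f → (1ℚ ℚ.+ 1ℚ) ℚ.- ε ℚ.< (+ f) ℚ./ suc N) (sym FF-I) (ratio-bound ε 0<ε)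
    where open Family (ℚ.denominator-1 ε)

open UpperBound using (firstFit≤2*OPT)
open Tightness using (firstFit-ratio-tight)
open import Data.Nat using (ℕ; suc; _*_; _≤_)
open import Data.Integer using (+_)
open import Data.Rational using (ℚ; _/_; _<_; _-_; 0ℚ; 1ℚ; _+_)
open import Data.Product using (Σ; _×_; _,_)

theorem2 : ((I : Instance) → ValidInstance I → NonIncreasingSlack I →
    (k : ℕ) → IsOPT I k → FF I ≤ 2 * k)
    ×
    ((ε : ℚ) → 0ℚ < ε →
    Σ Instance λ I → ValidInstance I × NonIncreasingSlack I ×
    Σ ℕ λ k → IsOPT I (suc k) × ((1ℚ + 1ℚ) - ε < (+ FF I) / suc k))
theorem2 = firstFit≤2*OPT , firstFit-ratio-tight
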